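{- Let $B$ be the infinite complete binary tree: the graph obtained by starting from a single root vertex and giving every vertex exactly two children, infinitely, with each vertex adjacent to its children (and its parent). Then $\chi_{td}(B)=7$.
   Context: For a (possibly infinite) graph $G$ and a positive integer $k$, a proper $k$-total difference labeling of $G$ is a function $f$ from $V(G)\cup E(G)$ to $\{1,2,\dots,k\}$ such that: (1) for every edge $\{u,v\}$, $f(\{u,v\})=|f(u)-f(v)|$; (2) adjacent vertices receive different labels; (3) two edges sharing a vertex receive different labels; (4) no edge receives the same label as one of its endpoints. $\chi_{td}(G)$ denotes the smallest $k$ for which $G$ has a proper $k$-total difference labeling. -}

module Defs where

open import Data.Nat using (ℕ; _≤_; ∣_-_∣)
open import Data.Bool using (Bool)
open import Data.List using (List; _∷_)
open import Data.Sum using (_⊎_)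
open import Data.Product using (_×_; _,_; proj₁; proj₂; ∃)
open import Relation.Binary.PropositionalEquality using (_≡_; _≢_)

-- A (possibly infinite) simple graph presented by its vertex set, its edge
-- set, and the two endpoints of each edge (each edge listed exactly once).
record Graph : Set₁ where
  field
    Vertex : Set
    Edge   : Set
    ends   : Edge → Vertex × Vertex

open Graph public

_∈ₑ_ : {G : Graph} → Vertex G → Edge G → Set
_∈ₑ_ {G} v e = (proj₁ (ends G e) ≡ v) ⊎ (proj₂ (ends G e) ≡ v)

InRange : ℕ → ℕ → Set
InRange k x = 1 ≤ x × x ≤ k

record ProperTotalDiffLabeling (G : Graph) (k : ℕ) : Set where
  field
    f : Vertex G → ℕ
    g : Edge G → ℕ
    f-range : ∀ v → InRange k (f v)
    g-range : ∀ e → InRange k (g e)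
    diff : ∀ e → g e ≡ ∣ f (proj₁ (ends G e)) - f (proj₂ (ends G e)) ∣
    adj-distinct : ∀ e → f (proj₁ (ends G e)) ≢ f (proj₂ (ends G e))
    edge-distinct : ∀ e e' → e ≢ e' → ∃ (λ v → _∈ₑ_ {G} v e × _∈ₑ_ {G} v e') → g e ≢ g e'
    edge-vertex-distinct : ∀ e v → _∈ₑ_ {G} v e → g e ≢ f v

χtd≡ : Graph → ℕ → Set
χtd≡ G k = ProperTotalDiffLabeling G k × (∀ m → ProperTotalDiffLabeling G m → k ≤ m)

-- The infinite complete binary tree: vertices are finite lists of Bools
-- (the path from the root; [] is the root); the children of v are
-- b ∷ v for b : Bool.
BinaryTree : Graph
BinaryTree = record
  { Vertex = List Bool
  ; Edge   = List Bool × Bool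
  ; ends   = λ { (v , b) → (v , b ∷ v) }
  }

-- Follow a labelling down the tree and record, at each non-root vertex, the pair
-- (label of the vertex, label of the edge to its parent). The pair at a vertex and the
-- labels of its two children are subject to purely local constraints, so the pairs that
-- can occur at a vertex with k levels below it form a set computable from the set for
-- k - 1. With labels in {1,…,6} this set is empty for k = 7, so no 6-labelling exists;
-- with labels in {1,…,7} every pair already has admissible children among all 49 pairs,
-- and choosing such children level by level builds a 7-labelling.
module Submission where

open import Defs
open import Data.Bool using (Bool; true; false)
open import Data.Empty using (⊥-elim)
open import Data.List using (List; []; _∷_; length; applyUpTo; cartesianProduct; filter)
open import Data.List.Membership.Propositional.Properties
  using (∈-applyUpTo⁺; ∈-applyUpTo⁻; ∈-cartesianProduct⁺; ∈-cartesianProduct⁻; ∈-filter⁺; ∈-filter⁻)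
open import Data.List.Relation.Unary.Any using (Any; here; any?; satisfied)
open import Data.List.Membership.Propositional using (_∈_; lose)
import Data.List.Membership.DecPropositional as DecMembership
open import Data.Nat using (ℕ; zero; suc; _≤_; ∣_-_∣; _≟_; _≤?_; s≤s; z≤n)
open import Data.Nat.Properties using (≤-trans; ≰⇒>; 1+n≢n)
open import Data.Product using (Σ; ∃; ∃₂; _×_; _,_; proj₁; proj₂)
open import Data.Product.Properties using (≡-dec)
open import Data.Sum using (inj₁; inj₂)
open import Function using (_∘_)
open import Relation.Nullary using (Dec; yes; no; ¬_; ¬?)
open import Relation.Nullary.Decidable using (_×-dec_; map′)
open import Relation.Unary using (Decidable)
open import Relation.Binary.PropositionalEquality using (_≡_; _≢_; refl; sym; trans; cong; subst)

-- (label of a vertex , label of the edge to its parent)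
State : Set
State = ℕ × ℕ

open DecMembership (≡-dec _≟_ _≟_) using (_∈?_)

labels : ℕ → List ℕ
labels n = applyUpTo suc n

∈-labels⁺ : ∀ {n x} → InRange n x → x ∈ labels n
∈-labels⁺ {x = suc i} (_ , i<n) = ∈-applyUpTo⁺ suc i<n

∈-labels⁻ : ∀ {n x} → x ∈ labels n → InRange n x
∈-labels⁻ x∈ with _ , i<n , refl ← ∈-applyUpTo⁻ suc x∈ = s≤s z≤n , i<n

states : ℕ → List State
states n = cartesianProduct (labels n) (labels n)

ProperTotalDiffLabeling-mono : ∀ {G m n} → m ≤ n → ProperTotalDiffLabeling G m → ProperTotalDiffLabeling G n
ProperTotalDiffLabeling-mono m≤n L = record
  { f = f ; g = g ; diff = diff ; adj-distinct = adj-distinct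
  ; edge-distinct = edge-distinct ; edge-vertex-distinct = edge-vertex-distinct
  ; f-range = weaken ∘ f-range
  ; g-range = weaken ∘ g-range
  }
  where
  open ProperTotalDiffLabeling L
  weaken : ∀ {x} → InRange _ x → InRange _ x
  weaken (1≤x , x≤m) = 1≤x , ≤-trans x≤m m≤n

x∷xs≢xs : ∀ {A : Set} {x : A} xs → x ∷ xs ≢ xs
x∷xs≢xs xs = 1+n≢n ∘ cong length

record ProperEdge (a c : ℕ) : Set where
  field
    labels≢ : a ≢ c
    ≢upper  : ∣ a - c ∣ ≢ a
    ≢lower  : ∣ a - c ∣ ≢ c

record ProperStar (a d c₁ c₂ : ℕ) : Set where
  field
    proper₁  : ProperEdge a c₁
    proper₂  : ProperEdge a c₂
    siblings : ∣ a - c₁ ∣ ≢ ∣ a - c₂ ∣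
    parent₁  : ∣ a - c₁ ∣ ≢ d
    parent₂  : ∣ a - c₂ ∣ ≢ d

_≢?_ : (x y : ℕ) → Dec (x ≢ y)
x ≢? y = ¬? (x ≟ y)

properEdge? : ∀ a c → Dec (ProperEdge a c)
properEdge? a c = map′ (λ (p , q , r) → record { labels≢ = p ; ≢upper = q ; ≢lower = r })
  (λ e → let open ProperEdge e in labels≢ , ≢upper , ≢lower)
  ((a ≢? c) ×-dec (∣ a - c ∣ ≢? a) ×-dec (∣ a - c ∣ ≢? c))

properStar? : ∀ a d c₁ c₂ → Dec (ProperStar a d c₁ c₂)
properStar? a d c₁ c₂ =
  map′ (λ (p , q , r , s , t) → record { proper₁ = p ; proper₂ = q ; siblings = r ; parent₁ = s ; parent₂ = t })
    (λ F → let open ProperStar F in proper₁ , proper₂ , siblings , parent₁ , parent₂)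
    (properEdge? a c₁ ×-dec properEdge? a c₂ ×-dec (∣ a - c₁ ∣ ≢? ∣ a - c₂ ∣)
      ×-dec (∣ a - c₁ ∣ ≢? d) ×-dec (∣ a - c₂ ∣ ≢? d))

Children : List State → State → ℕ → ℕ → Set
Children T (a , d) c₁ c₂ = ProperStar a d c₁ c₂ × (c₁ , ∣ a - c₁ ∣) ∈ T × (c₂ , ∣ a - c₂ ∣) ∈ T

children? : ∀ T s c₁ c₂ → Dec (Children T s c₁ c₂)
children? T (a , d) c₁ c₂ = properStar? a d c₁ c₂ ×-dec (c₁ , ∣ a - c₁ ∣) ∈? T ×-dec (c₂ , ∣ a - c₂ ∣) ∈? T

Extends : ℕ → List State → State → Set
Extends n T s = Any (λ c₁ → Any (Children T s c₁) (labels n)) (labels n)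

extends? : ∀ n T → Decidable (Extends n T)
extends? n T s = any? (λ c₁ → any? (children? T s c₁) (labels n)) (labels n)

-- (a , d) survives k rounds iff a vertex in state (a , d) can be followed by k more
-- levels of a labelling with labels in {1,…,n}.
survivors : ℕ → ℕ → List State
survivors n zero    = states n
survivors n (suc k) = filter (extends? n (survivors n k)) (states n)

survivors⊆states : ∀ n k {s} → s ∈ survivors n k → s ∈ states n
survivors⊆states n zero    s∈ = s∈
survivors⊆states n (suc k) s∈ = proj₁ (∈-filter⁻ (extends? n (survivors n k)) {xs = states n} s∈)

survivors-extend : ∀ n k {s} → s ∈ survivors n (suc k) → Extends n (survivors n k) s
survivors-extend n k s∈ = proj₂ (∈-filter⁻ (extends? n (survivors n k)) {xs = states n} s∈)

module Survival {n} (L : ProperTotalDiffLabeling BinaryTree n) where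
  open ProperTotalDiffLabeling L

  stateBelow : List Bool → Bool → State
  stateBelow v b = f (b ∷ v) , g (v , b)

  stateBelow∈states : ∀ v b → stateBelow v b ∈ states n
  stateBelow∈states v b = ∈-cartesianProduct⁺ (∈-labels⁺ (f-range (b ∷ v))) (∈-labels⁺ (g-range (v , b)))

  properEdgeAt : ∀ u b → ProperEdge (f u) (f (b ∷ u))
  properEdgeAt u b = record
    { labels≢ = adj-distinct (u , b)
    ; ≢upper  = edge-vertex-distinct (u , b) u (inj₁ refl) ∘ trans (diff (u , b))
    ; ≢lower  = edge-vertex-distinct (u , b) (b ∷ u) (inj₂ refl) ∘ trans (diff (u , b))
    }

  childEdge≢parentEdge : ∀ v b b′ → ∣ f (b ∷ v) - f (b′ ∷ b ∷ v) ∣ ≢ g (v , b)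
  childEdge≢parentEdge v b b′ =
    edge-distinct (b ∷ v , b′) (v , b) (x∷xs≢xs v ∘ cong proj₁) (b ∷ v , inj₁ refl , inj₂ refl)
    ∘ trans (diff (b ∷ v , b′))

  properStarBelow : ∀ v b → ProperStar (f (b ∷ v)) (g (v , b)) (f (true ∷ b ∷ v)) (f (false ∷ b ∷ v))
  properStarBelow v b = record
    { proper₁  = properEdgeAt (b ∷ v) true
    ; proper₂  = properEdgeAt (b ∷ v) false
    ; siblings = λ eq → edge-distinct (b ∷ v , true) (b ∷ v , false) (λ ()) (b ∷ v , inj₁ refl , inj₁ refl)
                          (trans (diff _) (trans eq (sym (diff _))))
    ; parent₁  = childEdge≢parentEdge v b true
    ; parent₂  = childEdge≢parentEdge v b false
    }

  stateBelow-survives : ∀ k v b → stateBelow v b ∈ survivors n k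
  stateBelow-survives zero    v b = stateBelow∈states v b
  stateBelow-survives (suc k) v b = ∈-filter⁺ (extends? n (survivors n k)) (stateBelow∈states v b)
    (lose (∈-labels⁺ (f-range (true ∷ u))) (lose (∈-labels⁺ (f-range (false ∷ u)))
      (properStarBelow v b , below true , below false)))
    where
    u = b ∷ v
    below : ∀ b′ → (f (b′ ∷ u) , ∣ f u - f (b′ ∷ u) ∣) ∈ survivors n k
    below b′ = subst (λ e → (f (b′ ∷ u) , e) ∈ survivors n k) (diff (u , b′)) (stateBelow-survives k u b′)

extinct⇒noLabeling : ∀ n k → survivors n k ≡ [] → ¬ ProperTotalDiffLabeling BinaryTree n
extinct⇒noLabeling n k extinct L with () ← subst (_ ∈_) extinct (Survival.stateBelow-survives L k [] true)

module LabelingFromClosedSet {n} (S : List State)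
  (S⊆states : ∀ {s} → s ∈ S → s ∈ states n)
  (closed : ∀ {s} → s ∈ S → Extends n S s)
  {root : State} (root∈S : root ∈ S) where

  Node : Set
  Node = Σ State (_∈ S)

  chooseChildren : ∀ {s} → s ∈ S → ∃₂ (Children S s)
  chooseChildren s∈S =
    let c₁ , c₂∈ = satisfied (closed s∈S)
        c₂ , children = satisfied c₂∈
    in c₁ , c₂ , children

  child : Node → Bool → Node
  child ((a , _) , s∈S) true  = let c₁ , _ , _ , c₁∈S , _ = chooseChildren s∈S in (c₁ , ∣ a - c₁ ∣) , c₁∈S
  child ((a , _) , s∈S) false = let _ , c₂ , _ , _ , c₂∈S = chooseChildren s∈S in (c₂ , ∣ a - c₂ ∣) , c₂∈S

  -- The second component of the root's state labels no edge; it only adds constraints.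
  node : List Bool → Node
  node []      = root , root∈S
  node (b ∷ v) = child (node v) b

  f : List Bool → ℕ
  f v = proj₁ (proj₁ (node v))

  g : Edge BinaryTree → ℕ
  g (v , b) = proj₂ (proj₁ (node (b ∷ v)))

  properStarAt : ∀ v → ProperStar (f v) (proj₂ (proj₁ (node v))) (f (true ∷ v)) (f (false ∷ v))
  properStarAt v = proj₁ (proj₂ (proj₂ (chooseChildren (proj₂ (node v)))))
  open ProperStar

  properEdgeAt : ∀ v b → ProperEdge (f v) (f (b ∷ v))
  properEdgeAt v true  = proper₁ (properStarAt v)
  properEdgeAt v false = proper₂ (properStarAt v)

  diff : ∀ v b → g (v , b) ≡ ∣ f v - f (b ∷ v) ∣
  diff v true  = refl
  diff v false = refl

  siblingEdges : ∀ v b b′ → b ≢ b′ → g (v , b) ≢ g (v , b′)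
  siblingEdges v true  true  b≢b′ = ⊥-elim (b≢b′ refl)
  siblingEdges v true  false _    = siblings (properStarAt v)
  siblingEdges v false true  _    = siblings (properStarAt v) ∘ sym
  siblingEdges v false false b≢b′ = ⊥-elim (b≢b′ refl)

  childEdge≢parentEdge : ∀ v b b′ → g (b ∷ v , b′) ≢ g (v , b)
  childEdge≢parentEdge v b true  = parent₁ (properStarAt (b ∷ v))
  childEdge≢parentEdge v b false = parent₂ (properStarAt (b ∷ v))

  edgeLabels-distinct : ∀ e e′ → e ≢ e′ → ∃ (λ w → _∈ₑ_ {BinaryTree} w e × _∈ₑ_ {BinaryTree} w e′) → g e ≢ g e′
  edgeLabels-distinct (v , b) (v , b′) e≢e′ (_ , inj₁ refl , inj₁ refl) = siblingEdges v b b′ (e≢e′ ∘ cong (v ,_))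
  edgeLabels-distinct (_ , b) (v , b′) _    (_ , inj₁ refl , inj₂ refl) = childEdge≢parentEdge v b′ b
  edgeLabels-distinct (v , b) (_ , b′) _    (_ , inj₂ refl , inj₁ refl) = childEdge≢parentEdge v b b′ ∘ sym
  edgeLabels-distinct _       _        e≢e′ (_ , inj₂ refl , inj₂ refl) = ⊥-elim (e≢e′ refl)

  edge≢endpoint : ∀ e w → _∈ₑ_ {BinaryTree} w e → g e ≢ f w
  edge≢endpoint (v , b) _ (inj₁ refl) = subst (_≢ f v) (sym (diff v b)) (ProperEdge.≢upper (properEdgeAt v b))
  edge≢endpoint (v , b) _ (inj₂ refl) = subst (_≢ f (b ∷ v)) (sym (diff v b)) (ProperEdge.≢lower (properEdgeAt v b))

  nodeLabels∈ : ∀ v → f v ∈ labels n × proj₂ (proj₁ (node v)) ∈ labels n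
  nodeLabels∈ v = ∈-cartesianProduct⁻ (labels n) (labels n) (S⊆states (proj₂ (node v)))

  labeling : ProperTotalDiffLabeling BinaryTree n
  labeling = record
    { f = f
    ; g = g
    ; f-range = ∈-labels⁻ ∘ proj₁ ∘ nodeLabels∈
    ; g-range = λ (v , b) → ∈-labels⁻ (proj₂ (nodeLabels∈ (b ∷ v)))
    ; diff = λ (v , b) → diff v b
    ; adj-distinct = λ (v , b) → ProperEdge.labels≢ (properEdgeAt v b)
    ; edge-distinct = edgeLabels-distinct
    ; edge-vertex-distinct = edge≢endpoint
    }

stable⇒labeling : ∀ n k → survivors n (suc k) ≡ survivors n k →
                  ∀ {s} → s ∈ survivors n k → ProperTotalDiffLabeling BinaryTree n
stable⇒labeling n k stable = LabelingFromClosedSet.labeling (survivors n k) (survivors⊆states n k) closed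
  where
  closed : ∀ {s} → s ∈ survivors n k → Extends n (survivors n k) s
  closed = survivors-extend n k ∘ subst (_ ∈_) (sym stable)

lowerBound : ∀ m → ProperTotalDiffLabeling BinaryTree m → 7 ≤ m
lowerBound m L with m ≤? 6
... | yes m≤6 = ⊥-elim (extinct⇒noLabeling 6 7 refl (ProperTotalDiffLabeling-mono m≤6 L))
... | no  m≰6 = ≰⇒> m≰6

mainTheorem6 : χtd≡ BinaryTree 7
mainTheorem6 = stable⇒labeling 7 0 refl (here refl) , lowerBound
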